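{- Let $n\geq 3$. There exists an acyclic hypergraph with vertex set $[n]^{(2)}$, all of whose hyperedges are triangles $\Delta(t)$ for $t\in[n]^{(3)}$, and which has exactly two components: one containing precisely the $3$ vertices of $\Delta(3,2,1)$, and the other containing all other vertices.
   Context: $[n]=\{1,\ldots,n\}$ and $[n]^{(k)}$ is the set of ordered $k$-tuples of distinct elements of $[n]$. For a triple $(a,b,c)\in[n]^{(3)}$, the triangle is $\Delta(a,b,c):=\{(a,b),(b,c),(c,a)\}\subset[n]^{(2)}$ (so $\Delta(a,b,c)=\Delta(c,a,b)\neq\Delta(c,b,a)$). A hypergraph $(V,H)$ consists of a vertex set $V$ and a set $H$ of nonempty subsets of $V$ (hyperedges). Its incidence graph is the bipartite graph on $V\cup H$ with an edge between $v\in V$ and $h\in H$ iff $v\in h$. Components of the hypergraph are components of its incidence graph; the hypergraph is connected if it has one component, and acyclic if its incidence graph is acyclic (a forest). -}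

module Defs where

open import Data.Nat using (ℕ; zero; suc; _≤_)
open import Data.Nat.DivMod using (_mod_)
open import Data.Fin using (Fin; toℕ)
open import Data.Product using (Σ; _×_; _,_; proj₁; proj₂)
open import Data.Sum using (_⊎_; inj₁; inj₂)
open import Data.List using (List; length; lookup)
open import Relation.Binary.PropositionalEquality using (_≡_; _≢_)
open import Relation.Binary.Construct.Closure.ReflexiveTransitive using (Star)
open import Function.Bundles using (_⇔_)

-- Generic hypergraphs via their incidence graphs.
-- Vertices form a type V; hyperedges are indexed by a type I, and
-- hyperedge i is the subset  E i : V → Set.

Node : (V I : Set) → Set
Node V I = V ⊎ I

data Adj {V I : Set} (E : I → V → Set) : Node V I → Node V I → Set where
  v-h : ∀ {v i} → E i v → Adj E (inj₁ v) (inj₂ i)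
  h-v : ∀ {v i} → E i v → Adj E (inj₂ i) (inj₁ v)

Connected : {V I : Set} (E : I → V → Set) → Node V I → Node V I → Set
Connected E = Star (Adj E)

csuc : ∀ {k} → Fin (suc k) → Fin (suc k)
csuc {k} i = suc (toℕ i) mod (suc k)

-- A cycle in the incidence graph: since it is bipartite and simple,
-- a cycle is  v₀ h₀ v₁ h₁ … v_{k-1} h_{k-1} v₀  with k ≥ 2, all vᵢ distinct,
-- all hᵢ distinct, vᵢ ∈ hᵢ and v_{i+1 mod k} ∈ hᵢ.
record Cycle {V I : Set} (E : I → V → Set) : Set where
  field
    k   : ℕ
    k≥1 : 1 ≤ k                    -- cycle length is 2(k+1) ≥ 4
    vs  : Fin (suc k) → V
    hs  : Fin (suc k) → I
    vs-inj : ∀ i j → vs i ≡ vs j → i ≡ j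
    hs-inj : ∀ i j → hs i ≡ hs j → i ≡ j
    inc₁   : ∀ i → E (hs i) (vs i)
    inc₂   : ∀ i → E (hs i) (vs (csuc i))

-- acyclic hypergraph: incidence graph is a forest (has no cycle)
Acyclic : {V I : Set} (E : I → V → Set) → Set
Acyclic E = Cycle E → Data.Empty.⊥
  where import Data.Empty

-- [n]^(2), [n]^(3) and triangles.  [n] = {1,…,n} is modelled by Fin n,
-- with the element i of Fin n standing for i+1.

Pair : ℕ → Set
Pair n = Fin n × Fin n

IsPair₂ : ∀ {n} → Pair n → Set
IsPair₂ (a , b) = a ≢ b

Triple : ℕ → Set
Triple n = Σ (Fin n × Fin n × Fin n)
             (λ { (a , b , c) → (a ≢ b) × (b ≢ c) × (a ≢ c) })

_∈Δ_ : ∀ {n} → Pair n → Fin n × Fin n × Fin n → Set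
x ∈Δ (a , b , c) = (x ≡ (a , b)) ⊎ (x ≡ (b , c)) ⊎ (x ≡ (c , a))

TriEdge : ∀ {n} (H : List (Triple n)) → Fin (length H) → Pair n → Set
TriEdge H i x = x ∈Δ proj₁ (lookup H i)

-- H is a *set* of hyperedges: distinct list positions give distinct triangles
DistinctTriangles : ∀ {n} → List (Triple n) → Set
DistinctTriangles {n} H =
  ∀ i j → (∀ (x : Pair n) → (TriEdge H i x ⇔ TriEdge H j x)) → i ≡ j

module Submission where

-- For every x ≥ 2 and i < x take
-- the triangle Δ(i, x, σ i x), σ i x the cyclic predecessor of i modulo x.  Its
-- "root" (σ i x , i) has both coordinates below x; its other two vertices
-- contain x, and for fixed x each such vertex lies in exactly one triangle.
--    The same criterion shows that distinct hyperedges are distinct sets.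
--  * Geometry of the triangles: ranked by x, they satisfy the criterion.
--  * Components: the only triangle meeting Δ(3,2,1) is Δ(3,2,1) itself, so
--    "lies in Δ(3,2,1)" is invariant along the incidence graph; every other
--    pair descends, one triangle at a time, to the pair (1,2).

open import Defs
open import Data.Nat using (ℕ; zero; suc; _+_; _≤_; _<_; _≤?_; s≤s; z≤n) renaming (_≟_ to _≟ℕ_)
open import Data.Nat.Properties
  using (≤-refl; ≤-reflexive; ≤-trans; ≤∧≢⇒<; ≤-total; <-irrefl; <⇒≢; <-≤-trans; <⇒≤; ≤-pred; 1+n≢n; suc-injective)
open import Data.Nat.DivMod using (_%_; n%n≡0; m<n⇒m%n≡m)
open import Data.Fin using (Fin; zero; suc; toℕ; fromℕ; inject₁; lower₁; pred; _≟_)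
open import Data.Fin.Properties
  using (toℕ-injective; toℕ-fromℕ; toℕ-fromℕ<; toℕ-inject₁; toℕ-lower₁; inject₁-lower₁; inject₁-injective; <-cmp; toℕ<n)
open import Data.Product using (Σ; _×_; _,_; proj₁; proj₂)
open import Data.Product.Properties using (≡-dec)
open import Data.Sum using (_⊎_; inj₁; inj₂)
open import Data.Empty using (⊥; ⊥-elim)
open import Data.List using (List; _∷_; length; map; lookup; filter; cartesianProduct; allFin)
open import Data.List.Relation.Unary.Any using (here; there)
open import Data.List.Relation.Unary.All as All using ()
open import Data.List.Relation.Unary.AllPairs using (_∷_)
open import Data.List.Relation.Unary.Unique.Propositional using (Unique)
open import Data.List.Relation.Unary.Unique.Propositional.Properties using (filter⁺; cartesianProduct⁺; allFin⁺)
open import Data.List.Membership.Propositional using (_∈_)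
open import Data.List.Membership.Propositional.Properties using (∈-filter⁺; ∈-filter⁻; ∈-cartesianProduct⁺; ∈-allFin)
open import Relation.Binary using (tri<; tri≈; tri>)
open import Relation.Binary.PropositionalEquality using (_≡_; _≢_; refl; sym; trans; cong; subst)
open import Relation.Binary.Construct.Closure.ReflexiveTransitive using (Star; ε; _◅_; _◅◅_; fold; reverse)
open import Relation.Nullary using (¬_; Dec; yes; no)
open import Relation.Nullary.Decidable using (_×-dec_; _⊎-dec_)
open import Function.Bundles using (_⇔_; mk⇔; Equivalence)
import Function.Properties.Equivalence as ⇔

last-or-inject₁ : ∀ {k} (i : Fin (suc k)) → i ≡ fromℕ k ⊎ Σ (Fin k) λ j → i ≡ inject₁ j
last-or-inject₁ {k} i with k ≟ℕ toℕ i
... | yes k≡i = inj₁ (toℕ-injective (trans (sym k≡i) (sym (toℕ-fromℕ k))))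
... | no k≢i  = inj₂ (lower₁ i k≢i , sym (inject₁-lower₁ i k≢i))

toℕ-csuc : ∀ {k} (i : Fin (suc k)) → toℕ (csuc i) ≡ suc (toℕ i) % suc k
toℕ-csuc i = toℕ-fromℕ< _

csuc-fromℕ : ∀ k → csuc (fromℕ k) ≡ zero
csuc-fromℕ k = toℕ-injective (trans (toℕ-csuc (fromℕ k))
  (trans (cong (λ t → suc t % suc k) (toℕ-fromℕ k)) (n%n≡0 (suc k))))

csuc-inject₁ : ∀ {k} (j : Fin k) → csuc (inject₁ j) ≡ suc j
csuc-inject₁ {k} j = toℕ-injective (trans (toℕ-csuc (inject₁ j))
  (trans (cong (λ t → suc t % suc k) (toℕ-inject₁ j))
    (m<n⇒m%n≡m (s≤s (toℕ<n j)))))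

csuc-predecessor : ∀ {k} (i : Fin (suc k)) → Σ (Fin (suc k)) λ p → csuc p ≡ i
csuc-predecessor {k} zero = fromℕ k , csuc-fromℕ k
csuc-predecessor (suc j) = inject₁ j , csuc-inject₁ j

csuc-moves : ∀ {k} → 1 ≤ k → (i : Fin (suc k)) → csuc i ≢ i
csuc-moves {suc k} _ i csuc-i≡i with last-or-inject₁ i
... | inj₁ refl = 0≢last (trans (sym (csuc-fromℕ (suc k))) csuc-i≡i)
  where
    0≢last : zero ≢ fromℕ (suc k)
    0≢last ()
... | inj₂ (j , refl) = 1+n≢n toℕ-equation
  where
    toℕ-equation : suc (toℕ j) ≡ toℕ j
    toℕ-equation = trans (cong toℕ (trans (sym (csuc-inject₁ j)) csuc-i≡i)) (toℕ-inject₁ j)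

argmax : ∀ {k} (f : Fin (suc k) → ℕ) → Σ (Fin (suc k)) λ i → ∀ j → f j ≤ f i
argmax {zero} f = zero , λ { zero → ≤-refl }
argmax {suc k} f with argmax (λ j → f (suc j))
... | i , max with ≤-total (f zero) (f (suc i))
...   | inj₁ f0≤ = suc i , λ { zero → f0≤ ; (suc j) → max j }
...   | inj₂ ≤f0 = zero , λ { zero → ≤-refl ; (suc j) → ≤-trans (max j) ≤f0 }

RootedRanking : {V I : Set} (E : I → V → Set) (rank : I → ℕ) (root : I → V) → Set
RootedRanking E rank root =
  ∀ {h h' v} → h ≢ h' → E h v → E h' v → rank h' ≤ rank h → v ≡ root h

module _ {V I : Set} {E : I → V → Set} {rank : I → ℕ} {root : I → V}
         (rooted : RootedRanking E rank root) where

  -- In a cycle, a hyperedge of maximal rank meets both neighbouring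
  -- hyperedges in its root, so its two cycle vertices coincide.
  rooted⇒acyclic : Acyclic E
  rooted⇒acyclic c = csuc-moves k≥1 i (sym (vs-inj i (csuc i) (trans vᵢ≡root (sym vⱼ≡root))))
    where
      open Cycle c
      i : Fin (suc k)
      i = proj₁ (argmax (λ j → rank (hs j)))
      maximal : ∀ j → rank (hs j) ≤ rank (hs i)
      maximal = proj₂ (argmax (λ j → rank (hs j)))
      p : Fin (suc k)
      p = proj₁ (csuc-predecessor i)
      p↦i : csuc p ≡ i
      p↦i = proj₂ (csuc-predecessor i)
      vⱼ≡root : vs (csuc i) ≡ root (hs i)
      vⱼ≡root = rooted (λ e → csuc-moves k≥1 i (sym (hs-inj _ _ e))) (inc₂ i) (inc₁ (csuc i)) (maximal (csuc i))
      vᵢ≡root : vs i ≡ root (hs i)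
      vᵢ≡root = rooted (λ e → csuc-moves k≥1 p (trans p↦i (hs-inj _ _ e)))
                       (inc₁ i) (subst (E (hs p)) (cong vs p↦i) (inc₂ p)) (maximal p)

  -- A hyperedge with two distinct vertices is not contained in a distinct
  -- hyperedge of no larger rank, since both vertices would be its root.
  rooted⇒not-contained : ∀ {h h' v w} → h ≢ h' → E h v → E h w → v ≢ w →
                          (∀ {u} → E h u → E h' u) → rank h' ≤ rank h → ⊥
  rooted⇒not-contained h≢h' v∈h w∈h v≢w h⊆h' rank≤ =
    v≢w (trans (rooted h≢h' v∈h (h⊆h' v∈h) rank≤) (sym (rooted h≢h' w∈h (h⊆h' w∈h) rank≤)))

  rooted⇒extensional : ((h h' : I) → Dec (h ≡ h')) →
                       (∀ h → Σ V λ v → Σ V λ w → E h v × E h w × v ≢ w) →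
                       ∀ h h' → (∀ u → E h u ⇔ E h' u) → h ≡ h'
  rooted⇒extensional _≟ᴵ_ two h h' same with h ≟ᴵ h'
  ... | yes h≡h' = h≡h'
  ... | no h≢h' with ≤-total (rank h') (rank h) | two h | two h'
  ...   | inj₁ rank≤ | v , w , v∈ , w∈ , v≢w | _ =
          ⊥-elim (rooted⇒not-contained h≢h' v∈ w∈ v≢w (Equivalence.to (same _)) rank≤)
  ...   | inj₂ rank≥ | _ | v , w , v∈ , w∈ , v≢w =
          ⊥-elim (rooted⇒not-contained (λ e → h≢h' (sym e)) v∈ w∈ v≢w (Equivalence.from (same _)) rank≥)

star-invariant : {A : Set} {R : A → A → Set} (Q : A → Set) →
                 (∀ {a b} → R a b → Q a ⇔ Q b) → ∀ {a b} → Star R a b → Q a ⇔ Q b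
star-invariant Q step = fold (λ a b → Q a ⇔ Q b) (λ r q → ⇔.trans (step r) q) ⇔.refl

flip-adjacency : {V I : Set} {E : I → V → Set} {p q : Node V I} → Adj E p q → Adj E q p
flip-adjacency (v-h e) = h-v e
flip-adjacency (h-v e) = v-h e

co-incident : {V I : Set} {E : I → V → Set} {h : I} {v w : V} → E h v → E h w → Connected E (inj₁ v) (inj₁ w)
co-incident v∈h w∈h = v-h v∈h ◅ h-v w∈h ◅ ε

module Positions {A B : Set} (f : A → B) where

  element : (xs : List A) → Fin (length (map f xs)) → A
  element (x ∷ xs) zero = x
  element (x ∷ xs) (suc p) = element xs p

  lookup-map : (xs : List A) (p : Fin (length (map f xs))) → lookup (map f xs) p ≡ f (element xs p)
  lookup-map (x ∷ xs) zero = refl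
  lookup-map (x ∷ xs) (suc p) = lookup-map xs p

  element-∈ : (xs : List A) (p : Fin (length (map f xs))) → element xs p ∈ xs
  element-∈ (x ∷ xs) zero = here refl
  element-∈ (x ∷ xs) (suc p) = there (element-∈ xs p)

  element-surjective : (xs : List A) {x : A} → x ∈ xs → Σ (Fin (length (map f xs))) λ p → element xs p ≡ x
  element-surjective (x ∷ xs) (here refl) = zero , refl
  element-surjective (x ∷ xs) (there x∈xs) with element-surjective xs x∈xs
  ... | p , e = suc p , e

  element-injective : (xs : List A) → Unique xs → ∀ p q → element xs p ≡ element xs q → p ≡ q
  element-injective (x ∷ xs) (x∉ ∷ _) zero zero _ = refl
  element-injective (x ∷ xs) (x∉ ∷ _) zero (suc q) e = ⊥-elim (All.lookup x∉ (element-∈ xs q) e)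
  element-injective (x ∷ xs) (x∉ ∷ _) (suc p) zero e = ⊥-elim (All.lookup x∉ (element-∈ xs p) (sym e))
  element-injective (x ∷ xs) (_ ∷ u) (suc p) (suc q) e = cong suc (element-injective xs u p q e)

-- For i < x,  σ i x  is  i - 1  modulo x:  σ 0 x = x - 1  and  σ (j+1) x = j.
σ : ∀ {n} → Fin (suc n) → Fin (suc n) → Fin (suc n)
σ zero x = pred x
σ (suc j) x = inject₁ j

toℕ-inject₁< : ∀ {k} (j : Fin k) → toℕ (inject₁ j) < suc (toℕ j)
toℕ-inject₁< j = s≤s (≤-reflexive (toℕ-inject₁ j))

module _ {n : ℕ} where

  σ<x : (i x : Fin (suc n)) → toℕ i < toℕ x → toℕ (σ i x) < toℕ x
  σ<x zero (suc y) _ = toℕ-inject₁< y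
  σ<x (suc j) x j<x = <-≤-trans (toℕ-inject₁< j) (<⇒≤ j<x)

  σ≢i : (i x : Fin (suc n)) → 2 ≤ toℕ x → σ i x ≢ i
  σ≢i zero (suc (suc y)) _ ()
  σ≢i zero (suc zero) (s≤s ())
  σ≢i (suc j) x _ e = <⇒≢ (toℕ-inject₁< j) (cong toℕ e)

  σ-injective : (i i' x : Fin (suc n)) → toℕ i < toℕ x → toℕ i' < toℕ x → σ i x ≡ σ i' x → i ≡ i'
  σ-injective zero zero x _ _ _ = refl
  σ-injective zero (suc j) (suc y) _ j<x e = ⊥-elim (<-irrefl (cong toℕ (inject₁-injective (sym e))) (≤-pred j<x))
  σ-injective (suc j) zero (suc y) j<x _ e = ⊥-elim (<-irrefl (cong toℕ (inject₁-injective e)) (≤-pred j<x))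
  σ-injective (suc j) (suc j') x _ _ e = cong suc (inject₁-injective e)

  σ-surjective : (x b : Fin (suc n)) → toℕ b < toℕ x → Σ (Fin (suc n)) λ i → toℕ i < toℕ x × σ i x ≡ b
  σ-surjective (suc y) b b<x with suc (toℕ b) ≟ℕ toℕ (suc y)
  ... | yes b+1≡x = zero , s≤s z≤n , toℕ-injective (trans (toℕ-inject₁ y) (sym (suc-injective b+1≡x)))
  ... | no b+1≢x = suc (lower₁ b n≢b) , b+1<x' , inject₁-lower₁ b n≢b
    where
      b+1<x : suc (toℕ b) < suc (toℕ y)
      b+1<x = ≤∧≢⇒< b<x b+1≢x
      n≢b : n ≢ toℕ b
      n≢b n≡b = <-irrefl (sym n≡b) (≤-trans (≤-pred b+1<x) (<⇒≤ (toℕ<n y)))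
      b+1<x' : suc (toℕ (lower₁ b n≢b)) < suc (toℕ y)
      b+1<x' = subst (λ t → suc t < suc (toℕ y)) (sym (toℕ-lower₁ b n≢b)) b+1<x

module Construction (m : ℕ) where

  N : ℕ
  N = 3 + m

  Label : Set
  Label = Fin N × Fin N

  Valid : Label → Set
  Valid (i , x) = toℕ i < toℕ x × 2 ≤ toℕ x

  valid? : (l : Label) → Dec (Valid l)
  valid? (i , x) = (suc (toℕ i) ≤? toℕ x) ×-dec (2 ≤? toℕ x)

  triangle : Label → Fin N × Fin N × Fin N
  triangle (i , x) = i , x , σ i x

  rank : Label → ℕ
  rank (i , x) = toℕ x

  root : Label → Pair N
  root (i , x) = σ i x , i

  -- Δ(1,3,2) = Δ(3,2,1), the triangle that forms a component by itself
  l₀ : Label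
  l₀ = zero , suc (suc zero)

  valid-l₀ : Valid l₀
  valid-l₀ = s≤s z≤n , s≤s (s≤s z≤n)

  -- the pair (1,2), to which every pair outside Δ(3,2,1) is connected
  base : Pair N
  base = zero , suc zero

  _≟²_ : (v w : Fin N × Fin N) → Dec (v ≡ w)
  _≟²_ = ≡-dec _≟_ _≟_

  _∈Δ?_ : (v : Pair N) (t : Fin N × Fin N × Fin N) → Dec (v ∈Δ t)
  v ∈Δ? (a , b , c) = (v ≟² (a , b)) ⊎-dec (v ≟² (b , c)) ⊎-dec (v ≟² (c , a))

  triangle-distinct : ∀ {i x} → Valid (i , x) → (i ≢ x) × (x ≢ σ i x) × (i ≢ σ i x)
  triangle-distinct {i} {x} (i<x , 2≤x) =
    (λ e → <⇒≢ i<x (cong toℕ e)) ,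
    (λ e → <⇒≢ (σ<x i x i<x) (cong toℕ (sym e))) ,
    (λ e → σ≢i i x 2≤x (sym e))

  below-≢ : {a y x : Fin N} → toℕ a < toℕ y → toℕ y ≤ toℕ x → a ≢ x
  below-≢ a<y y≤x refl = <-irrefl refl (<-≤-trans a<y y≤x)

  Upper : Label → Pair N → Set
  Upper (i , x) v = v ≡ (i , x) ⊎ v ≡ (x , σ i x)

  Contains : Fin N → Pair N → Set
  Contains x (a , b) = a ≡ x ⊎ b ≡ x

  upper-of-low-rank : ∀ {i' x' x v} → Valid (i' , x') → v ∈Δ triangle (i' , x') → toℕ x' ≤ toℕ x →
                      Contains x v → x' ≡ x × Upper (i' , x') v
  upper-of-low-rank (i'<x' , _) (inj₁ refl) x'≤x (inj₁ i'≡x) = ⊥-elim (below-≢ i'<x' x'≤x i'≡x)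
  upper-of-low-rank _ (inj₁ refl) _ (inj₂ x'≡x) = x'≡x , inj₁ refl
  upper-of-low-rank _ (inj₂ (inj₁ refl)) _ (inj₁ x'≡x) = x'≡x , inj₂ refl
  upper-of-low-rank {i'} {x'} (i'<x' , _) (inj₂ (inj₁ refl)) x'≤x (inj₂ σ≡x) =
    ⊥-elim (below-≢ (σ<x i' x' i'<x') x'≤x σ≡x)
  upper-of-low-rank {i'} {x'} (i'<x' , _) (inj₂ (inj₂ refl)) x'≤x (inj₁ σ≡x) =
    ⊥-elim (below-≢ (σ<x i' x' i'<x') x'≤x σ≡x)
  upper-of-low-rank (i'<x' , _) (inj₂ (inj₂ refl)) x'≤x (inj₂ i'≡x) = ⊥-elim (below-≢ i'<x' x'≤x i'≡x)

  upper-unique : ∀ {i i' x v} → Valid (i , x) → Valid (i' , x) → Upper (i , x) v → Upper (i' , x) v → i ≡ i'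
  upper-unique _ _ (inj₁ refl) (inj₁ refl) = refl
  upper-unique (i<x , _) _ (inj₁ refl) (inj₂ e) = ⊥-elim (below-≢ i<x ≤-refl (cong proj₁ e))
  upper-unique _ (i'<x , _) (inj₂ refl) (inj₁ e) = ⊥-elim (below-≢ i'<x ≤-refl (sym (cong proj₁ e)))
  upper-unique {i} {i'} {x} (i<x , _) (i'<x , _) (inj₂ refl) (inj₂ e) = σ-injective i i' x i<x i'<x (cong proj₂ e)

  triangle-shared : ∀ {l l' v} → Valid l → Valid l' → l ≢ l' → v ∈Δ triangle l → v ∈Δ triangle l' →
                    rank l' ≤ rank l → v ≡ root l
  triangle-shared _ _ _ (inj₂ (inj₂ v≡root)) _ _ = v≡root
  triangle-shared {i , x} vl vl' l≢l' (inj₁ refl) v∈l' x'≤x with upper-of-low-rank vl' v∈l' x'≤x (inj₂ refl)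
  ... | refl , upper' = ⊥-elim (l≢l' (cong (_, x) (upper-unique vl vl' (inj₁ refl) upper')))
  triangle-shared {i , x} vl vl' l≢l' (inj₂ (inj₁ refl)) v∈l' x'≤x with upper-of-low-rank vl' v∈l' x'≤x (inj₁ refl)
  ... | refl , upper' = ⊥-elim (l≢l' (cong (_, x) (upper-unique vl vl' (inj₂ refl) upper')))

  root-in-l₀ : (i x : Fin N) → root (i , x) ∈Δ triangle l₀ → (i , x) ≡ l₀
  root-in-l₀ zero (suc (suc zero)) _ = refl
  root-in-l₀ zero zero (inj₂ (inj₂ ()))
  root-in-l₀ zero (suc zero) (inj₂ (inj₂ ()))
  root-in-l₀ zero (suc (suc (suc y))) (inj₂ (inj₂ ()))
  root-in-l₀ (suc zero) x (inj₂ (inj₁ ()))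
  root-in-l₀ (suc (suc j)) x (inj₁ ())
  root-in-l₀ (suc (suc j)) x (inj₂ (inj₁ ()))
  root-in-l₀ (suc (suc j)) x (inj₂ (inj₂ ()))

  meets-l₀ : ∀ {l v} → Valid l → v ∈Δ triangle l → v ∈Δ triangle l₀ → l ≡ l₀
  meets-l₀ {l} {v} vl v∈l v∈l₀ with l ≟² l₀
  ... | yes l≡l₀ = l≡l₀
  ... | no l≢l₀ = root-in-l₀ _ _ (subst (_∈Δ triangle l₀) v≡root v∈l₀)
    where
      -- l₀ has the least rank 2, so a shared vertex is the root of l
      v≡root : v ≡ root l
      v≡root = triangle-shared vl valid-l₀ l≢l₀ v∈l v∈l₀ (proj₂ vl)

  pairs : List Label
  pairs = cartesianProduct (allFin N) (allFin N)

  labels : List Label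
  labels = filter valid? pairs

  labels-unique : Unique labels
  labels-unique = filter⁺ valid? (cartesianProduct⁺ (allFin⁺ N) (allFin⁺ N))

  -- A label as an element of [N]^(3); labels outside  labels  never occur, so
  -- the fallback value for them is irrelevant.
  asTriple : Label → Triple N
  asTriple l with valid? l
  ... | yes vl = triangle l , triangle-distinct vl
  ... | no _ = triangle l₀ , triangle-distinct valid-l₀

  asTriple-valid : ∀ {l} → Valid l → proj₁ (asTriple l) ≡ triangle l
  asTriple-valid {l} vl with valid? l
  ... | yes _ = refl
  ... | no ¬vl = ⊥-elim (¬vl vl)

  H : List (Triple N)
  H = map asTriple labels

  E : Fin (length H) → Pair N → Set
  E = TriEdge H

  open Positions asTriple

  label : Fin (length H) → Label
  label = element labels

  label-valid : ∀ h → Valid (label h)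
  label-valid h = proj₂ (∈-filter⁻ valid? {xs = pairs} (element-∈ labels h))

  label-injective : ∀ h h' → label h ≡ label h' → h ≡ h'
  label-injective = element-injective labels labels-unique

  label-surjective : ∀ {l} → Valid l → Σ (Fin (length H)) λ h → label h ≡ l
  label-surjective {i , x} vl =
    element-surjective labels (∈-filter⁺ valid? (∈-cartesianProduct⁺ (∈-allFin i) (∈-allFin x)) vl)

  edge-triangle : ∀ h {v} → E h v ⇔ v ∈Δ triangle (label h)
  edge-triangle h {v} = mk⇔ (subst (v ∈Δ_) edge≡) (subst (v ∈Δ_) (sym edge≡))
    where
      edge≡ : proj₁ (lookup H h) ≡ triangle (label h)
      edge≡ = trans (cong proj₁ (lookup-map labels h)) (asTriple-valid (label-valid h))

  edges-rooted : RootedRanking E (λ h → rank (label h)) (λ h → root (label h))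
  edges-rooted {h} {h'} h≢h' v∈h v∈h' =
    triangle-shared (label-valid h) (label-valid h') (λ e → h≢h' (label-injective h h' e))
      (Equivalence.to (edge-triangle h) v∈h) (Equivalence.to (edge-triangle h') v∈h')

  acyclic : Acyclic E
  acyclic = rooted⇒acyclic edges-rooted

  distinct : DistinctTriangles H
  distinct = rooted⇒extensional edges-rooted _≟_ two-vertices
    where
      -- the vertices (i , x) and (x , σ i x) of a triangle differ since i ≢ x
      two-vertices : ∀ h → Σ (Pair N) λ v → Σ (Pair N) λ w → E h v × E h w × v ≢ w
      two-vertices h =
        label h , (proj₂ (label h) , σ (proj₁ (label h)) (proj₂ (label h))) ,
        Equivalence.from (edge-triangle h) (inj₁ refl) ,
        Equivalence.from (edge-triangle h) (inj₂ (inj₁ refl)) ,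
        λ e → proj₁ (triangle-distinct (label-valid h)) (cong proj₁ e)

  InT₀ : Node (Pair N) (Fin (length H)) → Set
  InT₀ (inj₁ v) = v ∈Δ triangle l₀
  InT₀ (inj₂ h) = label h ≡ l₀

  incidence-InT₀ : ∀ {h v} → E h v → v ∈Δ triangle l₀ ⇔ label h ≡ l₀
  incidence-InT₀ {h} {v} v∈h =
    mk⇔ (meets-l₀ (label-valid h) v∈l) (λ l≡l₀ → subst (λ l → v ∈Δ triangle l) l≡l₀ v∈l)
    where
      v∈l : v ∈Δ triangle (label h)
      v∈l = Equivalence.to (edge-triangle h) v∈h

  adjacency-InT₀ : ∀ {p q} → Adj E p q → InT₀ p ⇔ InT₀ q
  adjacency-InT₀ (v-h {v} {h} v∈h) = incidence-InT₀ {h} {v} v∈h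
  adjacency-InT₀ (h-v {v} {h} v∈h) = ⇔.sym (incidence-InT₀ {h} {v} v∈h)

  same-triangle : ∀ {l v w} → Valid l → v ∈Δ triangle l → w ∈Δ triangle l → Connected E (inj₁ v) (inj₁ w)
  same-triangle vl v∈l w∈l with label-surjective vl
  ... | h , refl = co-incident {E = E} {h} (Equivalence.from (edge-triangle h) v∈l) (Equivalence.from (edge-triangle h) w∈l)

  stays-outside : ∀ {l v w} → Valid l → v ∈Δ triangle l → w ∈Δ triangle l →
                  ¬ v ∈Δ triangle l₀ → ¬ w ∈Δ triangle l₀
  stays-outside vl v∈l w∈l v∉l₀ w∈l₀ = v∉l₀ (subst (λ l → _ ∈Δ triangle l) (meets-l₀ vl w∈l w∈l₀) v∈l)

  lowest-increasing : (a b : Fin N) → toℕ a < toℕ b → ¬ 2 ≤ toℕ b → (a , b) ≡ base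
  lowest-increasing zero (suc zero) _ _ = refl
  lowest-increasing (suc a) (suc zero) (s≤s ()) _
  lowest-increasing a (suc (suc b)) _ b<2 = ⊥-elim (b<2 (s≤s (s≤s z≤n)))

  lowest-decreasing : (a b : Fin N) → toℕ b < toℕ a → ¬ 2 ≤ toℕ a → (a , b) ∈Δ triangle l₀
  lowest-decreasing (suc zero) zero _ _ = inj₂ (inj₂ refl)
  lowest-decreasing (suc zero) (suc b) (s≤s ()) _
  lowest-decreasing (suc (suc a)) b _ a<2 = ⊥-elim (a<2 (s≤s (s≤s z≤n)))

  -- A pair (a , b) outside Δ(3,2,1) with both coordinates below k is connected to
  -- (1,2): if a < b it shares the triangle (a , b) with (σ a b , a), and if
  -- b < a it shares the triangle (i , a) with (b , i), where σ i a = b; in both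
  -- cases the new pair has both coordinates below max(a , b).
  reach : ∀ k (a b : Fin N) → a ≢ b → ¬ (a , b) ∈Δ triangle l₀ → toℕ a < k → toℕ b < k →
          Connected E (inj₁ (a , b)) (inj₁ base)
  reach zero a b _ _ () _
  reach (suc k) a b a≢b out a<k b<k with <-cmp a b
  ... | tri≈ _ a≡b _ = ⊥-elim (a≢b a≡b)
  ... | tri< a<b _ _ with 2 ≤? toℕ b
  ...   | no b<2 = subst (λ w → Connected E (inj₁ w) (inj₁ base)) (sym (lowest-increasing a b a<b b<2)) ε
  ...   | yes 2≤b =
          same-triangle (a<b , 2≤b) (inj₁ refl) (inj₂ (inj₂ refl)) ◅◅
          reach k (σ a b) a (σ≢i a b 2≤b) (stays-outside (a<b , 2≤b) (inj₁ refl) (inj₂ (inj₂ refl)) out)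
                (<-≤-trans (σ<x a b a<b) (≤-pred b<k)) (<-≤-trans a<b (≤-pred b<k))
  reach (suc k) a b a≢b out a<k b<k | tri> _ _ b<a with 2 ≤? toℕ a
  ...   | no a<2 = ⊥-elim (out (lowest-decreasing a b b<a a<2))
  ...   | yes 2≤a with σ-surjective a b b<a
  ...     | i , i<a , refl =
          same-triangle (i<a , 2≤a) (inj₂ (inj₁ refl)) (inj₂ (inj₂ refl)) ◅◅
          reach k (σ i a) i (σ≢i i a 2≤a) (stays-outside (i<a , 2≤a) (inj₂ (inj₁ refl)) (inj₂ (inj₂ refl)) out)
                (<-≤-trans b<a (≤-pred a<k)) (<-≤-trans i<a (≤-pred a<k))

  reach-base : (u : Pair N) → IsPair₂ u → ¬ u ∈Δ triangle l₀ → Connected E (inj₁ u) (inj₁ base)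
  reach-base (a , b) a≢b out = reach N a b a≢b out (toℕ<n a) (toℕ<n b)

  components : ∀ u v → IsPair₂ u → IsPair₂ v →
               Connected E (inj₁ u) (inj₁ v) ⇔ (u ∈Δ triangle l₀ ⇔ v ∈Δ triangle l₀)
  components u v u₂ v₂ = mk⇔ (star-invariant InT₀ adjacency-InT₀) connect
    where
      connect : (u ∈Δ triangle l₀ ⇔ v ∈Δ triangle l₀) → Connected E (inj₁ u) (inj₁ v)
      connect same with u ∈Δ? triangle l₀
      ... | yes u∈l₀ = same-triangle valid-l₀ u∈l₀ (Equivalence.to same u∈l₀)
      ... | no u∉l₀ = reach-base u u₂ u∉l₀ ◅◅
                      reverse flip-adjacency (reach-base v v₂ (λ v∈l₀ → u∉l₀ (Equivalence.from same v∈l₀)))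

⇔-cong : {A A' B B' : Set} → A ⇔ A' → B ⇔ B' → (A ⇔ B) ⇔ (A' ⇔ B')
⇔-cong a b = mk⇔ (λ ab → ⇔.trans (⇔.sym a) (⇔.trans ab b)) (λ ab → ⇔.trans a (⇔.trans ab (⇔.sym b)))

Δ-rotate : ∀ {n} {v : Pair n} {a b c : Fin n} → v ∈Δ (c , a , b) ⇔ v ∈Δ (a , b , c)
Δ-rotate = mk⇔ (λ { (inj₁ e) → inj₂ (inj₂ e) ; (inj₂ (inj₁ e)) → inj₁ e ; (inj₂ (inj₂ e)) → inj₂ (inj₁ e) })
               (λ { (inj₁ e) → inj₂ (inj₁ e) ; (inj₂ (inj₁ e)) → inj₂ (inj₂ e) ; (inj₂ (inj₂ e)) → inj₁ e })

-- The construction describes the components through Δ(1,3,2), which is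
-- Δ(3,2,1) rotated.
proposition3 : (m : ℕ) →
    Σ (List (Triple (3 + m))) λ H →
      DistinctTriangles H ×
      Acyclic (TriEdge H) ×
      (∀ (u v : Pair (3 + m)) → IsPair₂ u → IsPair₂ v →
        (Connected (TriEdge H) (inj₁ u) (inj₁ v)
          ⇔ (u ∈Δ (suc (suc zero) , suc zero , zero)
              ⇔ v ∈Δ (suc (suc zero) , suc zero , zero))))
proposition3 m =
  H , distinct , acyclic ,
  λ u v u₂ v₂ → ⇔.trans (components u v u₂ v₂) (⇔-cong Δ-rotate Δ-rotate)
  where open Construction m
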